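{- Let $m\ge0$ and $N\ge1$ be integers. Then $$\sum_{j=1}^{\varphi(N)}H(r_j/N,m)-\varphi(N)H(1,m)=\sum_{j=1}^{\mu}\alpha_jH_{\alpha_jm}-\sum_{j=1}^{\eta}\beta_jH_{\beta_jm},$$ where $r_1,\dots,r_{\varphi(N)}$ are the integers in $\{1,\dots,N\}$ coprime to $N$ and $(\alpha_j)_{j=1}^\mu$, $(\beta_j)_{j=1}^\eta$ are the lists defined below.
   Context: $H(x,m)=\sum_{n=0}^{m-1}\frac1{x+n}$ (empty sum $=0$), $H_n=\sum_{i=1}^n1/i$, $\varphi$ is Euler's totient function. Let $p_1,\dots,p_\ell$ be the distinct prime divisors of $N$ and for $J\subseteq\{1,\dots,\ell\}$ put $p_J=\prod_{i\in J}p_i$ ($p_\emptyset=1$). The list $(\alpha_j)_{j=1}^\mu$ consists of the numbers $N/p_J$ for all $J$ with $|J|$ even (including $J=\emptyset$, giving $N$); the list $(\beta_j)_{j=1}^\eta$ consists of the numbers $N/p_J$ for all $J$ with $|J|$ odd, together with $\varphi(N)$ additional entries equal to $1$. -}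

module Defs where

open import Data.Nat as ℕ using (ℕ; zero; suc)
open import Data.Nat.DivMod using (_/_)
open import Data.Nat.Divisibility using (_∣?_)
open import Data.Nat.Coprimality using (coprime?)
open import Data.Nat.Primality using (prime?)
open import Data.List using (List; []; _∷_; _++_; map; filter; upTo; length; replicate; foldr)
open import Data.Nat.ListAction using (product)
open import Data.Integer using (+_)
open import Data.Rational as ℚ using (ℚ; 0ℚ; 1/_; ≢-nonZero)
open import Data.Rational.Properties using (_≟_)
open import Relation.Nullary using (yes; no)
open import Relation.Nullary.Decidable using (_×-dec_)

ℕ→ℚ : ℕ → ℚ
ℕ→ℚ n = + n ℚ./ 1

-- total reciprocal (1/0 := 0); only ever applied to positive rationals below
inv : ℚ → ℚ
inv q with q ≟ 0ℚ
... | yes _ = 0ℚ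
... | no ne = 1/_ q {{≢-nonZero ne}}

sumℚ : List ℚ → ℚ
sumℚ = foldr ℚ._+_ 0ℚ

H : ℚ → ℕ → ℚ
H x m = sumℚ (map (λ n → inv (x ℚ.+ ℕ→ℚ n)) (upTo m))

Harm : ℕ → ℚ
Harm n = sumℚ (map (λ i → (+ 1) ℚ./ suc i) (upTo n))

range1 : ℕ → List ℕ
range1 N = map suc (upTo N)

coprimes : ℕ → List ℕ
coprimes N = filter (λ r → coprime? r N) (range1 N)

φ : ℕ → ℕ
φ N = length (coprimes N)

primeDivisors : ℕ → List ℕ
primeDivisors N = filter (λ p → prime? p ×-dec (p ∣? N)) (range1 N)

subsets : {A : Set} → List A → List (List A)
subsets [] = [] ∷ []
subsets (x ∷ xs) = subsets xs ++ map (x ∷_) (subsets xs)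

-- natural division, with n / 0 := 0 (never used: p_J ≥ 1)
divℕ : ℕ → ℕ → ℕ
divℕ n zero = 0
divℕ n (suc d) = n / suc d


αs : ℕ → List ℕ
αs N = map (λ J → divℕ N (product J))
           (filter (λ J → length J ℕ.% 2 ℕ.≟ 0) (subsets (primeDivisors N)))

βs : ℕ → List ℕ
βs N = map (λ J → divℕ N (product J))
           (filter (λ J → length J ℕ.% 2 ℕ.≟ 1) (subsets (primeDivisors N)))
       ++ replicate (φ N) 1

-- Unfolding H(r/N, m) = Σ_{n<m} N/(r + nN) and letting r run over the residues coprime to N
-- turns the left-hand sum into N Σ_{k ≤ mN, (k,N)=1} 1/k, because coprimality to N only depends
-- on k mod N. Inclusion–exclusion over the prime divisors of N writes the indicator of (k,N)=1
-- as Σ_J (-1)^|J| [p_J ∣ k], and the multiples of p_J up to mN contribute (1/p_J) H_{mN/p_J}.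
-- So the sum equals Σ_J (-1)^|J| (N/p_J) H_{(N/p_J) m}, whose even and odd parts are the α- and
-- β-sums; the φ(N) extra entries 1 of β account for φ(N) H(1,m) = φ(N) H_m.
module Submission where

open import Defs

-- A local scope, so that _+_ and _*_ below are the operations of ℚ while the statement uses ℕ's _*_.
module _ where
  open import Data.Empty using (⊥-elim)
  open import Data.Integer as ℤ using (+_)
  import Data.Integer.Properties as ℤ
  open import Data.List using (List; []; _∷_; _++_; map; filter; upTo; applyUpTo; length; replicate)
  open import Data.List.Membership.Propositional using (_∈_)
  open import Data.List.Membership.Propositional.Properties
    using (∈-filter⁻; ∈-filter⁺; ∈-map⁺; ∈-map⁻; ∈-++⁻; ∈-upTo⁺)
  open import Data.List.Relation.Binary.Sublist.Propositional using (_⊆_; []; _∷_; _∷ʳ_)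
  open import Data.List.Relation.Binary.Sublist.Propositional.Properties using (All-resp-⊆)
  open import Data.List.Relation.Unary.All as All using (All; []; _∷_; all?)
  open import Data.List.Relation.Unary.AllPairs using (AllPairs; []; _∷_)
  import Data.List.Relation.Unary.AllPairs.Properties as AllPairs
  open import Data.List.Relation.Unary.Any using (here; there)
  open import Data.Maybe using (nothing)
  open import Data.Nat as ℕ using (ℕ; zero; suc; NonZero; _<_; s≤s; z≤n)
  import Data.Nat.Properties as ℕ
  open import Data.Nat.Coprimality using (Coprime; coprime?; coprime-divisor)
  open import Data.Nat.DivMod using (m/n*n≡m)
  open import Data.Nat.Divisibility
  open import Data.Nat.ListAction using (product)
  open import Data.Nat.Primality using (Prime; prime; prime?; euclidsLemma; prime⇒irreducible; prime⇒nonZero)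
  open import Data.Nat.Primality.Factorisation using (factorise)
  open import Data.Product using (∃-syntax; _×_; _,_; proj₁; proj₂)
  open import Data.Rational using (ℚ; 0ℚ; 1ℚ; 1/_; _+_; _*_; -_; _-_; _/_; ≢-nonZero; fromℚᵘ)
  import Data.Rational.Properties as ℚ
  open import Data.Rational.Unnormalised as ℚᵘ using (mkℚᵘ; *≡*)
  import Data.Rational.Unnormalised.Properties as ℚᵘ
  open import Data.Sum using (inj₁; inj₂)
  open import Function using (_∘_)
  open import Relation.Binary.PropositionalEquality
  open import Relation.Nullary using (yes; no; ¬_; Dec; ¬?)
  open import Relation.Nullary.Decidable using (_×-dec_)
  open import Relation.Unary using (Decidable)
  import Tactic.RingSolver as RingSolver
  import Tactic.RingSolver.Core.AlmostCommutativeRing as ACR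

  ℚ-ring : ACR.AlmostCommutativeRing _ _
  ℚ-ring = ACR.fromCommutativeRing ℚ.+-*-commutativeRing (λ _ → nothing)

  fromℚᵘ-homo-+ : ∀ p q → fromℚᵘ (p ℚᵘ.+ q) ≡ fromℚᵘ p + fromℚᵘ q
  fromℚᵘ-homo-+ p q = ℚ.toℚᵘ-injective (ℚᵘ.≃-trans (ℚ.toℚᵘ-fromℚᵘ _)
    (ℚᵘ.≃-trans (ℚᵘ.+-cong (ℚᵘ.≃-sym (ℚ.toℚᵘ-fromℚᵘ p)) (ℚᵘ.≃-sym (ℚ.toℚᵘ-fromℚᵘ q)))
      (ℚᵘ.≃-sym (ℚ.toℚᵘ-homo-+ (fromℚᵘ p) (fromℚᵘ q)))))

  fromℚᵘ-homo-* : ∀ p q → fromℚᵘ (p ℚᵘ.* q) ≡ fromℚᵘ p * fromℚᵘ q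
  fromℚᵘ-homo-* p q = ℚ.toℚᵘ-injective (ℚᵘ.≃-trans (ℚ.toℚᵘ-fromℚᵘ _)
    (ℚᵘ.≃-trans (ℚᵘ.*-cong (ℚᵘ.≃-sym (ℚ.toℚᵘ-fromℚᵘ p)) (ℚᵘ.≃-sym (ℚ.toℚᵘ-fromℚᵘ q)))
      (ℚᵘ.≃-sym (ℚ.toℚᵘ-homo-* (fromℚᵘ p) (fromℚᵘ q)))))

  ℕ→ℚ-+ : ∀ a b → ℕ→ℚ (a ℕ.+ b) ≡ ℕ→ℚ a + ℕ→ℚ b
  ℕ→ℚ-+ a b = trans (ℚ.fromℚᵘ-cong {mkℚᵘ (+ (a ℕ.+ b)) 0} {mkℚᵘ (+ a) 0 ℚᵘ.+ mkℚᵘ (+ b) 0} (*≡* eq))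
                    (fromℚᵘ-homo-+ (mkℚᵘ (+ a) 0) (mkℚᵘ (+ b) 0))
    where
    eq : + (a ℕ.+ b) ℤ.* + 1 ≡ (+ a ℤ.* + 1 ℤ.+ + b ℤ.* + 1) ℤ.* + 1
    eq = cong (ℤ._* + 1) (trans (ℤ.pos-+ a b)
           (sym (cong₂ ℤ._+_ (ℤ.*-identityʳ (+ a)) (ℤ.*-identityʳ (+ b)))))

  ℕ→ℚ-* : ∀ a b → ℕ→ℚ (a ℕ.* b) ≡ ℕ→ℚ a * ℕ→ℚ b
  ℕ→ℚ-* a b = trans (ℚ.fromℚᵘ-cong {mkℚᵘ (+ (a ℕ.* b)) 0} {mkℚᵘ (+ a) 0 ℚᵘ.* mkℚᵘ (+ b) 0}
                                     (*≡* (cong (ℤ._* + 1) (ℤ.pos-* a b))))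
                    (fromℚᵘ-homo-* (mkℚᵘ (+ a) 0) (mkℚᵘ (+ b) 0))

  ℕ→ℚ-suc≢0 : ∀ n → ℕ→ℚ (suc n) ≢ 0ℚ
  ℕ→ℚ-suc≢0 n eq with ℚᵘ.≃-trans (ℚᵘ.≃-sym (ℚ.toℚᵘ-fromℚᵘ (mkℚᵘ (+ suc n) 0))) (ℚ.toℚᵘ-cong eq)
  ... | *≡* e with trans (sym (ℤ.*-identityʳ (+ suc n))) e
  ...   | ()

  /-*-ℕ→ℚ : ∀ r N .{{_ : NonZero N}} → (+ r / N) * ℕ→ℚ N ≡ ℕ→ℚ r
  /-*-ℕ→ℚ r (suc n) = trans (sym (fromℚᵘ-homo-* (mkℚᵘ (+ r) n) (mkℚᵘ (+ suc n) 0)))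
    (ℚ.fromℚᵘ-cong {mkℚᵘ (+ r) n ℚᵘ.* mkℚᵘ (+ suc n) 0} {mkℚᵘ (+ r) 0}
      (*≡* (trans (ℤ.*-identityʳ _) (cong (λ d → + r ℤ.* + d) (sym (ℕ.*-identityʳ (suc n)))))))

  inv-unique : ∀ q x → q * x ≡ 1ℚ → inv q ≡ x
  inv-unique q x qx≡1 with q ℚ.≟ 0ℚ
  ... | yes refl with () ← trans (sym (ℚ.*-zeroˡ x)) qx≡1
  ... | no q≢0 = begin
      1/ q             ≡⟨ sym (ℚ.*-identityʳ _) ⟩
      1/ q * 1ℚ        ≡⟨ cong (1/ q *_) (sym qx≡1) ⟩
      1/ q * (q * x)   ≡⟨ sym (ℚ.*-assoc (1/ q) q x) ⟩
      (1/ q * q) * x   ≡⟨ cong (_* x) (ℚ.*-inverseˡ q) ⟩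
      1ℚ * x           ≡⟨ ℚ.*-identityˡ x ⟩
      x                ∎
    where
    open ≡-Reasoning
    instance _ = ≢-nonZero q≢0

  recip : ℕ → ℚ
  recip k = inv (ℕ→ℚ k)

  *-recip : ∀ n → ℕ→ℚ (suc n) * recip (suc n) ≡ 1ℚ
  *-recip n with ℕ→ℚ (suc n) ℚ.≟ 0ℚ
  ... | yes eq = ⊥-elim (ℕ→ℚ-suc≢0 n eq)
  ... | no ne = ℚ.*-inverseʳ (ℕ→ℚ (suc n)) {{≢-nonZero ne}}

  recip-* : ∀ a b → recip (suc a ℕ.* suc b) ≡ recip (suc a) * recip (suc b)
  recip-* a b = inv-unique (ℕ→ℚ (suc a ℕ.* suc b)) _ (begin
    ℕ→ℚ (suc a ℕ.* suc b) * (recip (suc a) * recip (suc b))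
      ≡⟨ cong (_* (recip (suc a) * recip (suc b))) (ℕ→ℚ-* (suc a) (suc b)) ⟩
    (ℕ→ℚ (suc a) * ℕ→ℚ (suc b)) * (recip (suc a) * recip (suc b))
      ≡⟨ interchange (ℕ→ℚ (suc a)) (ℕ→ℚ (suc b)) (recip (suc a)) (recip (suc b)) ⟩
    (ℕ→ℚ (suc a) * recip (suc a)) * (ℕ→ℚ (suc b) * recip (suc b))
      ≡⟨ cong₂ _*_ (*-recip a) (*-recip b) ⟩
    1ℚ ∎)
    where
    open ≡-Reasoning
    interchange : ∀ w x y z → (w * x) * (y * z) ≡ (w * y) * (x * z)
    interchange = RingSolver.solve-∀ ℚ-ring

  -- Finite sums

  sumBelow : ℕ → (ℕ → ℚ) → ℚ
  sumBelow zero    g = 0ℚ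
  sumBelow (suc n) g = g 0 + sumBelow n (g ∘ suc)

  syntax sumBelow n (λ i → e) = ∑[ i < n ] e

  sumOver : {A : Set} → (A → ℚ) → List A → ℚ
  sumOver g xs = sumℚ (map g xs)

  syntax sumOver (λ x → e) xs = ∑[ x ∈ xs ] e

  sumBelow-cong : ∀ n {g h} → (∀ i → i < n → g i ≡ h i) → sumBelow n g ≡ sumBelow n h
  sumBelow-cong zero    g≡h = refl
  sumBelow-cong (suc n) g≡h =
    cong₂ _+_ (g≡h 0 (s≤s z≤n)) (sumBelow-cong n (λ i i<n → g≡h (suc i) (s≤s i<n)))

  sumBelow-0 : ∀ n {g} → (∀ i → i < n → g i ≡ 0ℚ) → sumBelow n g ≡ 0ℚ
  sumBelow-0 n g≡0 = trans (sumBelow-cong n g≡0) (zeros n)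
    where
    zeros : ∀ n → sumBelow n (λ _ → 0ℚ) ≡ 0ℚ
    zeros zero    = refl
    zeros (suc n) = cong (_+_ 0ℚ) (zeros n)

  sumBelow-+ : ∀ n g h → ∑[ i < n ] (g i + h i) ≡ sumBelow n g + sumBelow n h
  sumBelow-+ zero    g h = refl
  sumBelow-+ (suc n) g h = trans (cong (_+_ (g 0 + h 0)) (sumBelow-+ n (g ∘ suc) (h ∘ suc)))
                                 (+-interchange (g 0) (h 0) _ _)
    where
    +-interchange : ∀ w x y z → w + x + (y + z) ≡ w + y + (x + z)
    +-interchange = RingSolver.solve-∀ ℚ-ring

  sumBelow-*ˡ : ∀ n c g → ∑[ i < n ] (c * g i) ≡ c * sumBelow n g
  sumBelow-*ˡ zero    c g = sym (ℚ.*-zeroʳ c)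
  sumBelow-*ˡ (suc n) c g = trans (cong (_+_ (c * g 0)) (sumBelow-*ˡ n c (g ∘ suc)))
                                  (sym (ℚ.*-distribˡ-+ c _ _))

  sumBelow-split : ∀ a b g → sumBelow (a ℕ.+ b) g ≡ sumBelow a g + ∑[ k < b ] g (a ℕ.+ k)
  sumBelow-split zero    b g = sym (ℚ.+-identityˡ _)
  sumBelow-split (suc a) b g = trans (cong (_+_ (g 0)) (sumBelow-split a b (g ∘ suc)))
                                     (sym (ℚ.+-assoc (g 0) _ _))

  sumBelow-suc : ∀ n g → sumBelow (suc n) g ≡ sumBelow n g + g n
  sumBelow-suc n g = begin
    sumBelow (suc n) g                      ≡⟨ cong (λ k → sumBelow k g) (ℕ.+-comm 1 n) ⟩
    sumBelow (n ℕ.+ 1) g                    ≡⟨ sumBelow-split n 1 g ⟩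
    sumBelow n g + (g (n ℕ.+ 0) + 0ℚ)       ≡⟨ cong (_+_ (sumBelow n g)) (ℚ.+-identityʳ _) ⟩
    sumBelow n g + g (n ℕ.+ 0)              ≡⟨ cong (λ k → sumBelow n g + g k) (ℕ.+-identityʳ n) ⟩
    sumBelow n g + g n                      ∎
    where open ≡-Reasoning

  sumBelow-swap : ∀ a b (g : ℕ → ℕ → ℚ) → ∑[ i < a ] sumBelow b (g i) ≡ ∑[ j < b ] ∑[ i < a ] g i j
  sumBelow-swap zero    b g = sym (sumBelow-0 b (λ _ _ → refl))
  sumBelow-swap (suc a) b g = trans (cong (_+_ (sumBelow b (g 0))) (sumBelow-swap a b (g ∘ suc)))
                                    (sym (sumBelow-+ b (g 0) _))

  sumBelow-blocks : ∀ m N g → ∑[ n < m ] ∑[ i < N ] g (i ℕ.+ n ℕ.* N) ≡ sumBelow (m ℕ.* N) g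
  sumBelow-blocks zero    N g = refl
  sumBelow-blocks (suc m) N g = sym (begin
    sumBelow (N ℕ.+ m ℕ.* N) g
      ≡⟨ sumBelow-split N (m ℕ.* N) g ⟩
    sumBelow N g + ∑[ k < m ℕ.* N ] g (N ℕ.+ k)
      ≡⟨ cong₂ _+_ (sumBelow-cong N (λ i _ → cong g (sym (ℕ.+-identityʳ i))))
                   (sym (sumBelow-blocks m N (λ k → g (N ℕ.+ k)))) ⟩
    ∑[ i < N ] g (i ℕ.+ 0) + ∑[ n < m ] ∑[ i < N ] g (N ℕ.+ (i ℕ.+ n ℕ.* N))
      ≡⟨ cong (_+_ (∑[ i < N ] g (i ℕ.+ 0)))
              (sumBelow-cong m (λ n _ → sumBelow-cong N (λ i _ → cong g (shift i n)))) ⟩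
    ∑[ n < suc m ] ∑[ i < N ] g (i ℕ.+ n ℕ.* N) ∎)
    where
    open ≡-Reasoning
    shift : ∀ i n → N ℕ.+ (i ℕ.+ n ℕ.* N) ≡ i ℕ.+ (N ℕ.+ n ℕ.* N)
    shift i n = trans (sym (ℕ.+-assoc N i _))
                      (trans (cong (ℕ._+ n ℕ.* N) (ℕ.+-comm N i)) (ℕ.+-assoc i N _))

  sumOver-applyUpTo : ∀ n (h : ℕ → ℕ) g → sumOver g (applyUpTo h n) ≡ ∑[ i < n ] g (h i)
  sumOver-applyUpTo zero    h g = refl
  sumOver-applyUpTo (suc n) h g = cong (_+_ (g (h 0))) (sumOver-applyUpTo n (h ∘ suc) g)

  sumOver-upTo : ∀ n g → sumOver g (upTo n) ≡ sumBelow n g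
  sumOver-upTo n = sumOver-applyUpTo n (λ i → i)

  sumOver-cong : {A : Set} (xs : List A) {g h : A → ℚ} →
                 (∀ x → x ∈ xs → g x ≡ h x) → sumOver g xs ≡ sumOver h xs
  sumOver-cong []       g≡h = refl
  sumOver-cong (x ∷ xs) g≡h = cong₂ _+_ (g≡h x (here refl)) (sumOver-cong xs (λ y y∈ → g≡h y (there y∈)))

  sumOver-- : {A : Set} (xs : List A) (g h : A → ℚ) → ∑[ x ∈ xs ] (g x - h x) ≡ sumOver g xs - sumOver h xs
  sumOver-- []       g h = refl
  sumOver-- (x ∷ xs) g h = trans (cong (_+_ (g x - h x)) (sumOver-- xs g h))
                                 (-‿interchange (g x) (h x) _ _)
    where
    -‿interchange : ∀ w x y z → w - x + (y - z) ≡ w + y - (x + z)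
    -‿interchange = RingSolver.solve-∀ ℚ-ring

  sumOver-*ˡ : {A : Set} (xs : List A) (c : ℚ) (g : A → ℚ) → ∑[ x ∈ xs ] (c * g x) ≡ c * sumOver g xs
  sumOver-*ˡ []       c g = sym (ℚ.*-zeroʳ c)
  sumOver-*ˡ (x ∷ xs) c g = trans (cong (_+_ (c * g x)) (sumOver-*ˡ xs c g)) (sym (ℚ.*-distribˡ-+ c _ _))

  sumOver-++ : {A : Set} (xs ys : List A) (g : A → ℚ) → sumOver g (xs ++ ys) ≡ sumOver g xs + sumOver g ys
  sumOver-++ []       ys g = sym (ℚ.+-identityˡ _)
  sumOver-++ (x ∷ xs) ys g = trans (cong (_+_ (g x)) (sumOver-++ xs ys g)) (sym (ℚ.+-assoc (g x) _ _))

  sumOver-map : {A B : Set} (xs : List A) (s : A → B) (g : B → ℚ) → sumOver g (map s xs) ≡ sumOver (g ∘ s) xs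
  sumOver-map []       s g = refl
  sumOver-map (x ∷ xs) s g = cong (_+_ (g (s x))) (sumOver-map xs s g)

  sumOver-replicate : {A : Set} (n : ℕ) (x : A) (g : A → ℚ) → sumOver g (replicate n x) ≡ ℕ→ℚ n * g x
  sumOver-replicate zero    x g = sym (ℚ.*-zeroˡ (g x))
  sumOver-replicate (suc n) x g = begin
    g x + sumOver g (replicate n x)  ≡⟨ cong (_+_ (g x)) (sumOver-replicate n x g) ⟩
    g x + ℕ→ℚ n * g x                ≡⟨ cong (_+ ℕ→ℚ n * g x) (sym (ℚ.*-identityˡ (g x))) ⟩
    1ℚ * g x + ℕ→ℚ n * g x          ≡⟨ sym (ℚ.*-distribʳ-+ (g x) 1ℚ (ℕ→ℚ n)) ⟩
    (1ℚ + ℕ→ℚ n) * g x               ≡⟨ cong (_* g x) (sym (ℕ→ℚ-+ 1 n)) ⟩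
    ℕ→ℚ (suc n) * g x                ∎
    where open ≡-Reasoning

  sumOver-sumBelow-swap : {A : Set} (xs : List A) (n : ℕ) (g : A → ℕ → ℚ) →
                          ∑[ x ∈ xs ] sumBelow n (g x) ≡ ∑[ i < n ] ∑[ x ∈ xs ] g x i
  sumOver-sumBelow-swap []       n g = sym (sumBelow-0 n (λ _ _ → refl))
  sumOver-sumBelow-swap (x ∷ xs) n g = trans (cong (_+_ (sumBelow n (g x))) (sumOver-sumBelow-swap xs n g))
                                             (sym (sumBelow-+ n (g x) _))

  𝟙 : {P : Set} → Dec P → ℚ
  𝟙 (yes _) = 1ℚ
  𝟙 (no _)  = 0ℚ

  𝟙-⇔ : {P Q : Set} → (P → Q) → (Q → P) → (p? : Dec P) (q? : Dec Q) → 𝟙 p? ≡ 𝟙 q?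
  𝟙-⇔ to from (yes _) (yes _) = refl
  𝟙-⇔ to from (yes p) (no ¬q) = ⊥-elim (¬q (to p))
  𝟙-⇔ to from (no ¬p) (yes q) = ⊥-elim (¬p (from q))
  𝟙-⇔ to from (no _)  (no _)  = refl

  𝟙-¬? : {P : Set} (p? : Dec P) → 𝟙 (¬? p?) ≡ 1ℚ - 𝟙 p?
  𝟙-¬? (yes _) = refl
  𝟙-¬? (no _)  = refl

  𝟙-×-dec : {P Q : Set} (p? : Dec P) (q? : Dec Q) → 𝟙 (p? ×-dec q?) ≡ 𝟙 p? * 𝟙 q?
  𝟙-×-dec (yes _) (yes _) = refl
  𝟙-×-dec (yes _) (no _)  = refl
  𝟙-×-dec (no _)  q?      = sym (ℚ.*-zeroˡ (𝟙 q?))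

  𝟙-all?-∷ : {A : Set} {P : A → Set} (P? : Decidable P) (x : A) (xs : List A) →
    𝟙 (all? P? (x ∷ xs)) ≡ 𝟙 (P? x) * 𝟙 (all? P? xs)
  𝟙-all?-∷ P? x xs = trans
    (𝟙-⇔ (λ { (px ∷ pxs) → px , pxs }) (λ (px , pxs) → px ∷ pxs) (all? P? (x ∷ xs)) (P? x ×-dec all? P? xs))
    (𝟙-×-dec (P? x) (all? P? xs))

  sumOver-filter : {A : Set} {P : A → Set} (P? : Decidable P) (xs : List A) (g : A → ℚ) →
                   sumOver g (filter P? xs) ≡ ∑[ x ∈ xs ] (𝟙 (P? x) * g x)
  sumOver-filter P? []       g = refl
  sumOver-filter P? (x ∷ xs) g with P? x
  ... | yes _ = cong₂ _+_ (sym (ℚ.*-identityˡ (g x))) (sumOver-filter P? xs g)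
  ... | no _  = trans (sumOver-filter P? xs g)
                      (sym (trans (cong (_+ _) (ℚ.*-zeroˡ (g x))) (ℚ.+-identityˡ _)))

  -- Divisibility and primes

  coprime⇒*∣ : ∀ {a b k} → Coprime a b → a ∣ k → b ∣ k → a ℕ.* b ∣ k
  coprime⇒*∣ {a} {b} a⊥b a∣k (divides t refl) with coprime-divisor a⊥b (subst (a ∣_) (ℕ.*-comm t b) a∣k)
  ... | divides s refl = divides s (ℕ.*-assoc s a b)

  𝟙-*-∣ : ∀ {a b} → Coprime a b → ∀ k → 𝟙 ((a ℕ.* b) ∣? k) ≡ 𝟙 (a ∣? k) * 𝟙 (b ∣? k)
  𝟙-*-∣ {a} {b} a⊥b k = trans
    (𝟙-⇔ (λ ab∣k → ∣-trans (m∣m*n b) ab∣k , ∣-trans (n∣m*n a) ab∣k) (λ (a∣k , b∣k) → coprime⇒*∣ a⊥b a∣k b∣k)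
         ((a ℕ.* b) ∣? k) (a ∣? k ×-dec b ∣? k))
    (𝟙-×-dec (a ∣? k) (b ∣? k))

  prime≢1 : ∀ {p} → Prime p → p ≢ 1
  prime≢1 (prime {{nt}} _) = ℕ.nonTrivial⇒≢1 {{nt}}

  prime∤⇒coprime : ∀ {p a} → Prime p → ¬ p ∣ a → Coprime p a
  prime∤⇒coprime {p} p-prime p∤a (i∣p , i∣a) with prime⇒irreducible p-prime i∣p
  ... | inj₁ i≡1 = i≡1
  ... | inj₂ refl = ⊥-elim (p∤a i∣a)

  prime∤prime : ∀ {p q} → Prime p → Prime q → p < q → ¬ p ∣ q
  prime∤prime p-prime q-prime p<q p∣q with prime⇒irreducible q-prime p∣q
  ... | inj₁ refl = prime≢1 p-prime refl
  ... | inj₂ refl = ℕ.<-irrefl refl p<q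

  prime∤product : ∀ {p J} → Prime p → All (p <_) J → All Prime J → ¬ p ∣ product J
  prime∤product {J = []}    p-prime []           []             p∣1 = prime≢1 p-prime (∣1⇒≡1 p∣1)
  prime∤product {J = q ∷ J} p-prime (p<q ∷ p<J) (q-prime ∷ J-prime) p∣qJ
    with euclidsLemma q (product J) p-prime p∣qJ
  ... | inj₁ p∣q = prime∤prime p-prime q-prime p<q p∣q
  ... | inj₂ p∣J = prime∤product p-prime p<J J-prime p∣J

  product-∣ : ∀ {J N} → AllPairs _<_ J → All Prime J → All (_∣ N) J → product J ∣ N
  product-∣ {[]}    {N} []           []                 []          = 1∣ N
  product-∣ {q ∷ J}     (q<J ∷ J<)   (q-prime ∷ J-prime) (q∣N ∷ J∣N) =
    coprime⇒*∣ (prime∤⇒coprime q-prime (prime∤product q-prime q<J J-prime)) q∣N (product-∣ J< J-prime J∣N)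

  ∃-prime-divisor : ∀ {n} → n ≢ 0 → n ≢ 1 → ∃[ p ] Prime p × p ∣ n
  ∃-prime-divisor {n} n≢0 n≢1 with factorise n {{ℕ.≢-nonZero n≢0}}
  ... | record { factors = [] ; isFactorisation = n≡1 } = ⊥-elim (n≢1 n≡1)
  ... | record { factors = p ∷ ps ; isFactorisation = n≡p*ps ; factorsPrime = p-prime ∷ _ } =
    p , p-prime , divides (product ps) (trans n≡p*ps (ℕ.*-comm p (product ps)))

  coprime-periodic : ∀ {r N} n → Coprime r N → Coprime (r ℕ.+ n ℕ.* N) N
  coprime-periodic {r} {N} n r⊥N {i} (i∣r+nN , i∣N) =
    r⊥N (∣m+n∣m⇒∣n (subst (i ∣_) (ℕ.+-comm r (n ℕ.* N)) i∣r+nN) (∣-trans i∣N (n∣m*n n)) , i∣N)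

  𝟙-coprime-periodic : ∀ r n N → 𝟙 (coprime? (r ℕ.+ n ℕ.* N) N) ≡ 𝟙 (coprime? r N)
  𝟙-coprime-periodic r n N = 𝟙-⇔ from (coprime-periodic n) (coprime? (r ℕ.+ n ℕ.* N) N) (coprime? r N)
    where
    from : Coprime (r ℕ.+ n ℕ.* N) N → Coprime r N
    from r+nN⊥N (i∣r , i∣N) = r+nN⊥N (∣m∣n⇒∣m+n i∣r (∣-trans i∣N (n∣m*n n)) , i∣N)

  -- Inclusion–exclusion over subsets of primes

  ∈-subsets⇒⊆ : {A : Set} {J xs : List A} → J ∈ subsets xs → J ⊆ xs
  ∈-subsets⇒⊆ {xs = []}     (here refl) = []
  ∈-subsets⇒⊆ {xs = x ∷ xs} J∈          with ∈-++⁻ (subsets xs) J∈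
  ... | inj₁ J∈xs  = x ∷ʳ ∈-subsets⇒⊆ J∈xs
  ... | inj₂ J∈x∷ with ∈-map⁻ (x ∷_) J∈x∷
  ...   | _ , J∈xs , refl = refl ∷ ∈-subsets⇒⊆ J∈xs

  AllPairs-resp-⊆ : {A : Set} {R : A → A → Set} {J xs : List A} → J ⊆ xs → AllPairs R xs → AllPairs R J
  AllPairs-resp-⊆ []         []          = []
  AllPairs-resp-⊆ (_ ∷ʳ τ)   (_ ∷ pxs)   = AllPairs-resp-⊆ τ pxs
  AllPairs-resp-⊆ (refl ∷ τ) (px ∷ pxs)  = All-resp-⊆ τ px ∷ AllPairs-resp-⊆ τ pxs

  sign : {A : Set} → List A → ℚ
  sign []       = 1ℚ
  sign (_ ∷ xs) = - sign xs

  sign-parity : {A : Set} (J : List A) → sign J ≡ 𝟙 (length J ℕ.% 2 ℕ.≟ 0) - 𝟙 (length J ℕ.% 2 ℕ.≟ 1)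
  sign-parity []          = refl
  sign-parity (_ ∷ [])    = refl
  sign-parity (_ ∷ _ ∷ J) = trans (neg-involutive (sign J)) (sign-parity J)
    where
    neg-involutive : ∀ x → - - x ≡ x
    neg-involutive = RingSolver.solve-∀ ℚ-ring

  inclusion-exclusion : ∀ {ps} → AllPairs _<_ ps → All Prime ps → ∀ k →
    ∑[ J ∈ subsets ps ] (sign J * 𝟙 (product J ∣? k)) ≡ 𝟙 (all? (λ p → ¬? (p ∣? k)) ps)
  inclusion-exclusion {[]} [] [] k with 1 ∣? k
  ... | yes _  = refl
  ... | no 1∤k = ⊥-elim (1∤k (1∣ k))
  inclusion-exclusion {p ∷ ps} (p<ps ∷ ps<) (p-prime ∷ ps-prime) k = begin
    sumOver g (subsets ps ++ map (p ∷_) (subsets ps))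
      ≡⟨ sumOver-++ (subsets ps) _ g ⟩
    S + sumOver g (map (p ∷_) (subsets ps))
      ≡⟨ cong (_+_ S) (trans (sumOver-map (subsets ps) (p ∷_) g) (sumOver-cong (subsets ps) with-p)) ⟩
    S + ∑[ J ∈ subsets ps ] ((- 𝟙 (p ∣? k)) * g J)
      ≡⟨ cong (_+_ S) (sumOver-*ˡ (subsets ps) (- 𝟙 (p ∣? k)) g) ⟩
    S + (- 𝟙 (p ∣? k)) * S
      ≡⟨ factor S (𝟙 (p ∣? k)) ⟩
    (1ℚ - 𝟙 (p ∣? k)) * S
      ≡⟨ cong₂ _*_ (sym (𝟙-¬? (p ∣? k))) (inclusion-exclusion ps< ps-prime k) ⟩
    𝟙 (¬? (p ∣? k)) * 𝟙 (all? (λ q → ¬? (q ∣? k)) ps)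
      ≡⟨ sym (𝟙-all?-∷ (λ q → ¬? (q ∣? k)) p ps) ⟩
    𝟙 (all? (λ q → ¬? (q ∣? k)) (p ∷ ps)) ∎
    where
    open ≡-Reasoning
    g : List ℕ → ℚ
    g J = sign J * 𝟙 (product J ∣? k)
    S : ℚ
    S = sumOver g (subsets ps)
    factor : ∀ s d → s + (- d) * s ≡ (1ℚ - d) * s
    factor = RingSolver.solve-∀ ℚ-ring
    rearrange : ∀ s a b → - s * (a * b) ≡ (- a) * (s * b)
    rearrange = RingSolver.solve-∀ ℚ-ring
    with-p : ∀ J → J ∈ subsets ps → g (p ∷ J) ≡ (- 𝟙 (p ∣? k)) * g J
    with-p J J∈ = trans (cong (- sign J *_) (𝟙-*-∣ p⊥J k)) (rearrange (sign J) (𝟙 (p ∣? k)) (𝟙 (product J ∣? k)))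
      where
      J⊆ps : J ⊆ ps
      J⊆ps = ∈-subsets⇒⊆ J∈
      p⊥J : Coprime p (product J)
      p⊥J = prime∤⇒coprime p-prime (prime∤product p-prime (All-resp-⊆ J⊆ps p<ps) (All-resp-⊆ J⊆ps ps-prime))

  module _ (N : ℕ) where
    isPrimeDivisor? : Decidable (λ p → Prime p × p ∣ N)
    isPrimeDivisor? p = prime? p ×-dec (p ∣? N)

    primeDivisors-prime : All Prime (primeDivisors N)
    primeDivisors-prime = All.tabulate (λ p∈ → proj₁ (proj₂ (∈-filter⁻ isPrimeDivisor? {xs = range1 N} p∈)))

    primeDivisors-∣ : All (_∣ N) (primeDivisors N)
    primeDivisors-∣ = All.tabulate (λ p∈ → proj₂ (proj₂ (∈-filter⁻ isPrimeDivisor? {xs = range1 N} p∈)))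

    primeDivisors-sorted : AllPairs _<_ (primeDivisors N)
    primeDivisors-sorted =
      AllPairs.filter⁺ isPrimeDivisor? (AllPairs.map⁺ (AllPairs.applyUpTo⁺₁ (λ i → i) N (λ i<j _ → s≤s i<j)))

    ∈-primeDivisors : ∀ {p} .{{_ : NonZero N}} → Prime p → p ∣ N → p ∈ primeDivisors N
    ∈-primeDivisors {zero}  p-prime _   with () ← prime⇒nonZero p-prime
    ∈-primeDivisors {suc _} p-prime p∣N =
      ∈-filter⁺ isPrimeDivisor? (∈-map⁺ suc (∈-upTo⁺ (∣⇒≤ p∣N))) (p-prime , p∣N)

    ∈-subsets⇒product∣ : ∀ {J} → J ∈ subsets (primeDivisors N) → product J ∣ N
    ∈-subsets⇒product∣ {J} J∈ = product-∣ (AllPairs-resp-⊆ J⊆ primeDivisors-sorted)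
                                      (All-resp-⊆ J⊆ primeDivisors-prime) (All-resp-⊆ J⊆ primeDivisors-∣)
      where
      J⊆ : J ⊆ primeDivisors N
      J⊆ = ∈-subsets⇒⊆ J∈

    coprime⇒∤primeDivisors : ∀ {k} → Coprime k N → All (λ p → ¬ p ∣ k) (primeDivisors N)
    coprime⇒∤primeDivisors k⊥N = All.tabulate (λ p∈ p∣k →
      prime≢1 (All.lookup primeDivisors-prime p∈) (k⊥N (p∣k , All.lookup primeDivisors-∣ p∈)))

    ∤primeDivisors⇒coprime : ∀ {k} .{{_ : NonZero N}} → All (λ p → ¬ p ∣ k) (primeDivisors N) → Coprime k N
    ∤primeDivisors⇒coprime ∤k {i} (i∣k , i∣N) with i ℕ.≟ 1
    ... | yes i≡1 = i≡1
    ... | no i≢1 with ∃-prime-divisor i≢0 i≢1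
      where
      i≢0 : i ≢ 0
      i≢0 i≡0 = ℕ.≢-nonZero⁻¹ N (0∣⇒≡0 (subst (_∣ N) i≡0 i∣N))
    ...   | p , p-prime , p∣i =
      ⊥-elim (All.lookup ∤k (∈-primeDivisors p-prime (∣-trans p∣i i∣N)) (∣-trans p∣i i∣k))

    𝟙-coprime≡∑sign : .{{_ : NonZero N}} → ∀ k →
      𝟙 (coprime? k N) ≡ ∑[ J ∈ subsets (primeDivisors N) ] (sign J * 𝟙 (product J ∣? k))
    𝟙-coprime≡∑sign k = trans (𝟙-⇔ coprime⇒∤primeDivisors ∤primeDivisors⇒coprime
                                   (coprime? k N) (all? (λ p → ¬? (p ∣? k)) (primeDivisors N)))
                              (sym (inclusion-exclusion primeDivisors-sorted primeDivisors-prime k))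

  -- Harmonic sums

  Harm≡∑recip : ∀ n → Harm n ≡ ∑[ i < n ] recip (suc i)
  Harm≡∑recip n = trans (sumOver-upTo n _) (sumBelow-cong n (λ i _ → sym (inv-unique (ℕ→ℚ (suc i)) _
    (trans (ℚ.*-comm (ℕ→ℚ (suc i)) (+ 1 / suc i)) (/-*-ℕ→ℚ 1 (suc i))))))

  H-1≡Harm : ∀ n → H 1ℚ n ≡ Harm n
  H-1≡Harm n = trans (sumOver-upTo n _)
    (trans (sumBelow-cong n (λ i _ → cong inv (sym (ℕ→ℚ-+ 1 i)))) (sym (Harm≡∑recip n)))

  H-/≡∑recip : ∀ r m N .{{_ : NonZero N}} →
    H (+ suc r / N) m ≡ ∑[ n < m ] (ℕ→ℚ N * recip (suc r ℕ.+ n ℕ.* N))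
  H-/≡∑recip r m N = trans (sumOver-upTo m _) (sumBelow-cong m (λ n _ → inv-unique (q + ℕ→ℚ n) _ (shifted n)))
    where
    open ≡-Reasoning
    q : ℚ
    q = + suc r / N
    expand : ∀ a b c d → (a + b) * (c * d) ≡ (a * c + b * c) * d
    expand = RingSolver.solve-∀ ℚ-ring
    shifted : ∀ n → (q + ℕ→ℚ n) * (ℕ→ℚ N * recip (suc r ℕ.+ n ℕ.* N)) ≡ 1ℚ
    shifted n = begin
      (q + ℕ→ℚ n) * (ℕ→ℚ N * recip k)             ≡⟨ expand q (ℕ→ℚ n) (ℕ→ℚ N) (recip k) ⟩
      (q * ℕ→ℚ N + ℕ→ℚ n * ℕ→ℚ N) * recip k       ≡⟨ cong (λ x → (x + ℕ→ℚ n * ℕ→ℚ N) * recip k) (/-*-ℕ→ℚ (suc r) N) ⟩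
      (ℕ→ℚ (suc r) + ℕ→ℚ n * ℕ→ℚ N) * recip k     ≡⟨ cong (λ x → (ℕ→ℚ (suc r) + x) * recip k) (sym (ℕ→ℚ-* n N)) ⟩
      (ℕ→ℚ (suc r) + ℕ→ℚ (n ℕ.* N)) * recip k     ≡⟨ cong (_* recip k) (sym (ℕ→ℚ-+ (suc r) (n ℕ.* N))) ⟩
      ℕ→ℚ k * recip k                             ≡⟨ *-recip (r ℕ.+ n ℕ.* N) ⟩
      1ℚ                                          ∎
      where
      k : ℕ
      k = suc r ℕ.+ n ℕ.* N

  -- Only the last term of each block of d consecutive integers is a multiple of d.
  ∑-recip-multiples : ∀ M d → ∑[ k < M ℕ.* suc d ] (𝟙 (suc d ∣? suc k) * recip (suc k)) ≡ recip (suc d) * Harm M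
  ∑-recip-multiples M d = begin
    sumBelow (M ℕ.* suc d) h                                 ≡⟨ sym (sumBelow-blocks M (suc d) h) ⟩
    ∑[ n < M ] ∑[ i < suc d ] h (i ℕ.+ n ℕ.* suc d)          ≡⟨ sumBelow-cong M (λ n _ → block n) ⟩
    ∑[ n < M ] (recip (suc d) * recip (suc n))               ≡⟨ sumBelow-*ˡ M (recip (suc d)) _ ⟩
    recip (suc d) * ∑[ n < M ] recip (suc n)                 ≡⟨ cong (recip (suc d) *_) (sym (Harm≡∑recip M)) ⟩
    recip (suc d) * Harm M                                   ∎
    where
    open ≡-Reasoning
    h : ℕ → ℚ
    h k = 𝟙 (suc d ∣? suc k) * recip (suc k)
    not-last : ∀ n i → i < d → h (i ℕ.+ n ℕ.* suc d) ≡ 0ℚ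
    not-last n i i<d with suc d ∣? suc (i ℕ.+ n ℕ.* suc d)
    ... | no _   = ℚ.*-zeroˡ (recip (suc (i ℕ.+ n ℕ.* suc d)))
    ... | yes d∣ = ⊥-elim (ℕ.<⇒≱ (s≤s i<d)
          (∣⇒≤ (∣m+n∣m⇒∣n (subst (suc d ∣_) (ℕ.+-comm (suc i) (n ℕ.* suc d)) d∣) (n∣m*n n))))
    last : ∀ n → h (d ℕ.+ n ℕ.* suc d) ≡ recip (suc d) * recip (suc n)
    last n with suc d ∣? suc (d ℕ.+ n ℕ.* suc d)
    ... | no d∤ = ⊥-elim (d∤ (n∣m*n (suc n)))
    ... | yes _ = trans (ℚ.*-identityˡ _) (trans (cong recip (ℕ.*-comm (suc n) (suc d))) (recip-* d n))
    block : ∀ n → ∑[ i < suc d ] h (i ℕ.+ n ℕ.* suc d) ≡ recip (suc d) * recip (suc n)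
    block n = trans (sumBelow-suc d _)
      (trans (cong₂ _+_ (sumBelow-0 d (λ i i<d → not-last n i i<d)) (last n)) (ℚ.+-identityˡ _))

  weightedHarm : ℕ → ℕ → ℚ
  weightedHarm m a = ℕ→ℚ a * Harm (a ℕ.* m)

  N*∑-recip-multiples : ∀ m N d .{{_ : NonZero N}} → d ∣ N →
    ℕ→ℚ N * ∑[ k < m ℕ.* N ] (𝟙 (d ∣? suc k) * recip (suc k)) ≡ weightedHarm m (divℕ N d)
  N*∑-recip-multiples m N zero    0∣N = ⊥-elim (ℕ.≢-nonZero⁻¹ N (0∣⇒≡0 0∣N))
  N*∑-recip-multiples m N (suc d) d∣N = begin
    ℕ→ℚ N * sumBelow (m ℕ.* N) h
      ≡⟨ cong₂ (λ a b → a * sumBelow b h) N≡qd mN≡qmd ⟩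
    (ℕ→ℚ q * ℕ→ℚ (suc d)) * sumBelow (q ℕ.* m ℕ.* suc d) h
      ≡⟨ cong ((ℕ→ℚ q * ℕ→ℚ (suc d)) *_) (∑-recip-multiples (q ℕ.* m) d) ⟩
    (ℕ→ℚ q * ℕ→ℚ (suc d)) * (recip (suc d) * Harm (q ℕ.* m))
      ≡⟨ rearrange (ℕ→ℚ q) (ℕ→ℚ (suc d)) (recip (suc d)) (Harm (q ℕ.* m)) ⟩
    weightedHarm m q * (ℕ→ℚ (suc d) * recip (suc d))
      ≡⟨ trans (cong (weightedHarm m q *_) (*-recip d)) (ℚ.*-identityʳ _) ⟩
    weightedHarm m q ∎
    where
    open ≡-Reasoning
    h : ℕ → ℚ
    h k = 𝟙 (suc d ∣? suc k) * recip (suc k)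
    q : ℕ
    q = divℕ N (suc d)
    qd≡N : q ℕ.* suc d ≡ N
    qd≡N = m/n*n≡m d∣N
    N≡qd : ℕ→ℚ N ≡ ℕ→ℚ q * ℕ→ℚ (suc d)
    N≡qd = trans (cong ℕ→ℚ (sym qd≡N)) (ℕ→ℚ-* q (suc d))
    mN≡qmd : m ℕ.* N ≡ q ℕ.* m ℕ.* suc d
    mN≡qmd = trans (cong (m ℕ.*_) (sym qd≡N))
                   (trans (sym (ℕ.*-assoc m q (suc d))) (cong (ℕ._* suc d) (ℕ.*-comm m q)))
    rearrange : ∀ a b c x → (a * b) * (c * x) ≡ (a * x) * (b * c)
    rearrange = RingSolver.solve-∀ ℚ-ring

  ∑-H-coprimes : ∀ m N .{{_ : NonZero N}} →
    ∑[ r ∈ coprimes N ] H (+ r / N) m ≡ ℕ→ℚ N * ∑[ k < m ℕ.* N ] (𝟙 (coprime? (suc k) N) * recip (suc k))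
  ∑-H-coprimes m N = begin
    ∑[ r ∈ coprimes N ] H (+ r / N) m
      ≡⟨ sumOver-filter (λ r → coprime? r N) (range1 N) _ ⟩
    ∑[ r ∈ range1 N ] (𝟙 (coprime? r N) * H (+ r / N) m)
      ≡⟨ trans (sumOver-map (upTo N) suc _) (sumOver-upTo N _) ⟩
    ∑[ i < N ] (𝟙 (coprime? (suc i) N) * H (+ suc i / N) m)
      ≡⟨ sumBelow-cong N (λ i _ → residue-class i) ⟩
    ∑[ i < N ] ∑[ n < m ] g (i ℕ.+ n ℕ.* N)
      ≡⟨ sumBelow-swap N m _ ⟩
    ∑[ n < m ] ∑[ i < N ] g (i ℕ.+ n ℕ.* N)
      ≡⟨ sumBelow-blocks m N g ⟩
    sumBelow (m ℕ.* N) g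
      ≡⟨ sumBelow-*ˡ (m ℕ.* N) (ℕ→ℚ N) _ ⟩
    ℕ→ℚ N * ∑[ k < m ℕ.* N ] (𝟙 (coprime? (suc k) N) * recip (suc k)) ∎
    where
    open ≡-Reasoning
    g : ℕ → ℚ
    g k = ℕ→ℚ N * (𝟙 (coprime? (suc k) N) * recip (suc k))
    swap : ∀ a b c → a * (b * c) ≡ b * (a * c)
    swap = RingSolver.solve-∀ ℚ-ring
    residue-class : ∀ i → 𝟙 (coprime? (suc i) N) * H (+ suc i / N) m ≡ ∑[ n < m ] g (i ℕ.+ n ℕ.* N)
    residue-class i = begin
      𝟙 (coprime? (suc i) N) * H (+ suc i / N) m
        ≡⟨ cong (𝟙 (coprime? (suc i) N) *_) (H-/≡∑recip i m N) ⟩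
      𝟙 (coprime? (suc i) N) * ∑[ n < m ] (ℕ→ℚ N * recip (suc i ℕ.+ n ℕ.* N))
        ≡⟨ sym (sumBelow-*ˡ m (𝟙 (coprime? (suc i) N)) _) ⟩
      ∑[ n < m ] (𝟙 (coprime? (suc i) N) * (ℕ→ℚ N * recip (suc i ℕ.+ n ℕ.* N)))
        ≡⟨ sumBelow-cong m (λ n _ → periodic n) ⟩
      ∑[ n < m ] g (i ℕ.+ n ℕ.* N) ∎
      where
      periodic : ∀ n → 𝟙 (coprime? (suc i) N) * (ℕ→ℚ N * recip (suc i ℕ.+ n ℕ.* N)) ≡ g (i ℕ.+ n ℕ.* N)
      periodic n = trans (swap (𝟙 (coprime? (suc i) N)) (ℕ→ℚ N) (recip (suc i ℕ.+ n ℕ.* N)))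
        (cong (λ c → ℕ→ℚ N * (c * recip (suc i ℕ.+ n ℕ.* N))) (sym (𝟙-coprime-periodic (suc i) n N)))

  ∑-coprime-recip≡∑sign : ∀ M N .{{_ : NonZero N}} →
    ∑[ k < M ] (𝟙 (coprime? (suc k) N) * recip (suc k))
      ≡ ∑[ J ∈ subsets (primeDivisors N) ] (sign J * ∑[ k < M ] (𝟙 (product J ∣? suc k) * recip (suc k)))
  ∑-coprime-recip≡∑sign M N = begin
    ∑[ k < M ] (𝟙 (coprime? (suc k) N) * recip (suc k))
      ≡⟨ sumBelow-cong M (λ k _ → cong (_* recip (suc k)) (𝟙-coprime≡∑sign N (suc k))) ⟩
    ∑[ k < M ] (sumOver (s k) Js * recip (suc k))
      ≡⟨ sumBelow-cong M (λ k _ → distrib k) ⟩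
    ∑[ k < M ] ∑[ J ∈ Js ] (recip (suc k) * s k J)
      ≡⟨ sym (sumOver-sumBelow-swap Js M _) ⟩
    ∑[ J ∈ Js ] ∑[ k < M ] (recip (suc k) * s k J)
      ≡⟨ sumOver-cong Js (λ J _ → pull-sign J) ⟩
    ∑[ J ∈ Js ] (sign J * ∑[ k < M ] (𝟙 (product J ∣? suc k) * recip (suc k))) ∎
    where
    open ≡-Reasoning
    Js : List (List ℕ)
    Js = subsets (primeDivisors N)
    s : ℕ → List ℕ → ℚ
    s k J = sign J * 𝟙 (product J ∣? suc k)
    rearrange : ∀ r σ d → r * (σ * d) ≡ σ * (d * r)
    rearrange = RingSolver.solve-∀ ℚ-ring
    distrib : ∀ k → sumOver (s k) Js * recip (suc k) ≡ ∑[ J ∈ Js ] (recip (suc k) * s k J)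
    distrib k = trans (ℚ.*-comm (sumOver (s k) Js) (recip (suc k))) (sym (sumOver-*ˡ Js (recip (suc k)) (s k)))
    pull-sign : ∀ J → ∑[ k < M ] (recip (suc k) * s k J) ≡ sign J * ∑[ k < M ] (𝟙 (product J ∣? suc k) * recip (suc k))
    pull-sign J = trans (sumBelow-cong M (λ k _ → rearrange (recip (suc k)) (sign J) (𝟙 (product J ∣? suc k))))
                        (sumBelow-*ˡ M (sign J) _)

  ∑-H-coprimes≡∑sign : ∀ m N .{{_ : NonZero N}} →
    ∑[ r ∈ coprimes N ] H (+ r / N) m
      ≡ ∑[ J ∈ subsets (primeDivisors N) ] (sign J * weightedHarm m (divℕ N (product J)))
  ∑-H-coprimes≡∑sign m N = begin
    ∑[ r ∈ coprimes N ] H (+ r / N) m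
      ≡⟨ ∑-H-coprimes m N ⟩
    ℕ→ℚ N * ∑[ k < m ℕ.* N ] (𝟙 (coprime? (suc k) N) * recip (suc k))
      ≡⟨ cong (ℕ→ℚ N *_) (∑-coprime-recip≡∑sign (m ℕ.* N) N) ⟩
    ℕ→ℚ N * ∑[ J ∈ Js ] (sign J * T J)
      ≡⟨ sym (sumOver-*ˡ Js (ℕ→ℚ N) _) ⟩
    ∑[ J ∈ Js ] (ℕ→ℚ N * (sign J * T J))
      ≡⟨ sumOver-cong Js (λ J J∈ → trans (swap (ℕ→ℚ N) (sign J) (T J))
           (cong (sign J *_) (N*∑-recip-multiples m N (product J) (∈-subsets⇒product∣ N J∈)))) ⟩
    ∑[ J ∈ Js ] (sign J * weightedHarm m (divℕ N (product J))) ∎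
    where
    open ≡-Reasoning
    Js : List (List ℕ)
    Js = subsets (primeDivisors N)
    T : List ℕ → ℚ
    T J = ∑[ k < m ℕ.* N ] (𝟙 (product J ∣? suc k) * recip (suc k))
    swap : ∀ a b c → a * (b * c) ≡ b * (a * c)
    swap = RingSolver.solve-∀ ℚ-ring

  ∑αs-∑βs≡∑sign : ∀ m N →
    ∑[ a ∈ αs N ] weightedHarm m a - ∑[ b ∈ βs N ] weightedHarm m b
      ≡ ∑[ J ∈ subsets (primeDivisors N) ] (sign J * weightedHarm m (divℕ N (product J))) - ℕ→ℚ (φ N) * Harm m
  ∑αs-∑βs≡∑sign m N = begin
    sumOver v (αs N) - sumOver v (βs N)
      ≡⟨ cong₂ _-_ (sumOver-map (filter even? Js) p/ v) ∑βs ⟩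
    sumOver w (filter even? Js) - (sumOver w (filter odd? Js) + Φ * v 1)
      ≡⟨ cong₂ (λ x y → x - (y + Φ * v 1)) (sumOver-filter even? Js w) (sumOver-filter odd? Js w) ⟩
    E - (O + Φ * v 1)
      ≡⟨ regroup E O _ ⟩
    (E - O) - Φ * v 1
      ≡⟨ cong₂ _-_ (sym (sumOver-- Js _ _)) (cong (Φ *_) v1≡Harm) ⟩
    ∑[ J ∈ Js ] (𝟙 (even? J) * w J - 𝟙 (odd? J) * w J) - Φ * Harm m
      ≡⟨ cong (_- Φ * Harm m) (sumOver-cong Js (λ J _ → signed J)) ⟩
    ∑[ J ∈ Js ] (sign J * w J) - Φ * Harm m ∎
    where
    open ≡-Reasoning
    Js : List (List ℕ)
    Js = subsets (primeDivisors N)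
    Φ : ℚ
    Φ = ℕ→ℚ (φ N)
    v : ℕ → ℚ
    v = weightedHarm m
    p/ : List ℕ → ℕ
    p/ J = divℕ N (product J)
    w : List ℕ → ℚ
    w = v ∘ p/
    even? : Decidable (λ (J : List ℕ) → length J ℕ.% 2 ≡ 0)
    even? J = length J ℕ.% 2 ℕ.≟ 0
    odd? : Decidable (λ (J : List ℕ) → length J ℕ.% 2 ≡ 1)
    odd? J = length J ℕ.% 2 ℕ.≟ 1
    E O : ℚ
    E = ∑[ J ∈ Js ] (𝟙 (even? J) * w J)
    O = ∑[ J ∈ Js ] (𝟙 (odd? J) * w J)
    ∑βs : sumOver v (βs N) ≡ sumOver w (filter odd? Js) + Φ * v 1
    ∑βs = trans (sumOver-++ (map p/ (filter odd? Js)) _ v)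
                (cong₂ _+_ (sumOver-map (filter odd? Js) p/ v) (sumOver-replicate (φ N) 1 v))
    v1≡Harm : v 1 ≡ Harm m
    v1≡Harm = trans (ℚ.*-identityˡ _) (cong Harm (ℕ.+-identityʳ m))
    regroup : ∀ x y z → x - (y + z) ≡ (x - y) - z
    regroup = RingSolver.solve-∀ ℚ-ring
    split : ∀ a b c → a * c - b * c ≡ (a - b) * c
    split = RingSolver.solve-∀ ℚ-ring
    signed : ∀ J → 𝟙 (even? J) * w J - 𝟙 (odd? J) * w J ≡ sign J * w J
    signed J = trans (split (𝟙 (even? J)) (𝟙 (odd? J)) (w J)) (cong (_* w J) (sym (sign-parity J)))

open import Data.Nat using (ℕ; _*_)
open import Data.Nat.Base using (NonZero)
open import Data.List using (map)
open import Data.Integer using (+_)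
import Data.Rational as ℚ
open import Relation.Binary.PropositionalEquality using (_≡_; cong₂; trans; sym)

lemma27 : (m N : ℕ) → .{{_ : NonZero N}} →
    sumℚ (map (λ r → H ((+ r) ℚ./ N) m) (coprimes N)) ℚ.- ℕ→ℚ (φ N) ℚ.* H ℚ.1ℚ m
    ≡ sumℚ (map (λ a → ℕ→ℚ a ℚ.* Harm (a * m)) (αs N))
    ℚ.- sumℚ (map (λ b → ℕ→ℚ b ℚ.* Harm (b * m)) (βs N))
lemma27 m N = trans (cong₂ (λ x y → x ℚ.- ℕ→ℚ (φ N) ℚ.* y) (∑-H-coprimes≡∑sign m N) (H-1≡Harm m))
                    (sym (∑αs-∑βs≡∑sign m N))
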